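{- For every integer $n\ge 0$, there is a bijection between the set of isomorphism classes of $XY$-graphs on $n$ vertices and the set of isomorphism classes of unbalanced split graphs on $n+1$ vertices.
   Context: An $XY$-graph is a bipartite graph together with a specified ordered bipartition $X\cup Y$ of its vertex set (every edge joins a vertex of $X$ to a vertex of $Y$; $X$ is the distinguished part; $X$ or $Y$ may be empty). Two $XY$-graphs are isomorphic if there is a graph isomorphism mapping $X$ onto $X'$ and $Y$ onto $Y'$. A finite graph $G$ is a split graph if its vertex set can be partitioned as $K\cup S$ with $K$ a clique and $S$ a stable set (a $KS$-partition). A split graph is balanced if it has a $KS$-partition with $|K|=\omega(G)$ (the clique number) and $|S|=\alpha(G)$ (the independence number), and unbalanced otherwise. Graphs are considered up to isomorphism. -}

module Defs where

open import Data.Nat using (ℕ; suc; _≤_)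
open import Data.Bool using (Bool; true; false)
open import Data.Fin using (Fin)
open import Data.Fin.Subset using (Subset; _∈_; ∁; ∣_∣)
open import Data.Fin.Permutation using (Permutation′; _⟨$⟩ʳ_; _⟨$⟩ˡ_; inverseʳ; id; flip; _∘ₚ_)
open import Data.Product using (Σ; ∃; _×_; _,_; proj₁; proj₂)
open import Relation.Nullary using (¬_)
open import Relation.Binary.PropositionalEquality
  using (_≡_; _≢_; refl; sym; trans; cong₂)
open import Relation.Binary.Bundles using (Setoid)
open import Relation.Binary.Structures using (IsEquivalence)

record Graph (n : ℕ) : Set where
  field
    adj    : Fin n → Fin n → Bool
    adj-sym : ∀ i j → adj i j ≡ adj j i
    adj-irrefl : ∀ i → adj i i ≡ false
open Graph public

_≅_ : {n : ℕ} → Graph n → Graph n → Set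
_≅_ {n} G H = Σ (Permutation′ n) λ π → ∀ i j → adj H (π ⟨$⟩ʳ i) (π ⟨$⟩ʳ j) ≡ adj G i j

≅-refl : {n : ℕ} {G : Graph n} → G ≅ G
≅-refl = id , λ i j → refl

≅-sym : {n : ℕ} {G H : Graph n} → G ≅ H → H ≅ G
≅-sym {G = G} {H} (π , h) = flip π , λ i j →
  trans (sym (h (π ⟨$⟩ˡ i) (π ⟨$⟩ˡ j)))
        (cong₂ (adj H) (inverseʳ π) (inverseʳ π))

≅-trans : {n : ℕ} {G H K : Graph n} → G ≅ H → H ≅ K → G ≅ K
≅-trans (π , h) (ρ , k) = (π ∘ₚ ρ) , λ i j → trans (k _ _) (h i j)

-- XY-graphs: a graph with an ordered bipartition X ∪ Y
-- (side i ≡ true means i ∈ X, side i ≡ false means i ∈ Y); every edge joins X to Y.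

record XYGraph (n : ℕ) : Set where
  field
    graph     : Graph n
    side      : Fin n → Bool
    bipartite : ∀ i j → adj graph i j ≡ true → side i ≢ side j
open XYGraph public

_≅XY_ : {n : ℕ} → XYGraph n → XYGraph n → Set
_≅XY_ {n} G H = Σ (Permutation′ n) λ π →
  (∀ i j → adj (graph H) (π ⟨$⟩ʳ i) (π ⟨$⟩ʳ j) ≡ adj (graph G) i j) ×
  (∀ i → side H (π ⟨$⟩ʳ i) ≡ side G i)

≅XY-refl : {n : ℕ} {G : XYGraph n} → G ≅XY G
≅XY-refl = id , (λ i j → refl) , (λ i → refl)

≅XY-sym : {n : ℕ} {G H : XYGraph n} → G ≅XY H → H ≅XY G
≅XY-sym {G = G} {H} (π , h , s) = flip π ,
  (λ i j → trans (sym (h (π ⟨$⟩ˡ i) (π ⟨$⟩ˡ j)))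
                 (cong₂ (adj (graph H)) (inverseʳ π) (inverseʳ π))) ,
  (λ i → trans (sym (s (π ⟨$⟩ˡ i))) (helper (inverseʳ π)))
  where
    helper : ∀ {a b} → a ≡ b → side H a ≡ side H b
    helper refl = refl

≅XY-trans : {n : ℕ} {G H K : XYGraph n} → G ≅XY H → H ≅XY K → G ≅XY K
≅XY-trans (π , h , s) (ρ , k , t) =
  (π ∘ₚ ρ) , (λ i j → trans (k _ _) (h i j)) , (λ i → trans (t _) (s i))

XYGraphs : ℕ → Setoid _ _
XYGraphs n = record
  { Carrier = XYGraph n
  ; _≈_ = _≅XY_
  ; isEquivalence = record { refl = λ {G} → ≅XY-refl {G = G} ; sym = λ {G} {H} → ≅XY-sym {G = G} {H} ; trans = λ {G} {H} {K} → ≅XY-trans {G = G} {H} {K} }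
  }

IsClique : {n : ℕ} → Graph n → Subset n → Set
IsClique G C = ∀ i j → i ∈ C → j ∈ C → i ≢ j → adj G i j ≡ true

IsStable : {n : ℕ} → Graph n → Subset n → Set
IsStable G S = ∀ i j → i ∈ S → j ∈ S → adj G i j ≡ false

IsCliqueNumber : {n : ℕ} → Graph n → ℕ → Set
IsCliqueNumber G k =
  (Σ _ λ C → IsClique G C × ∣ C ∣ ≡ k) × (∀ C → IsClique G C → ∣ C ∣ ≤ k)

IsIndependenceNumber : {n : ℕ} → Graph n → ℕ → Set
IsIndependenceNumber G k =
  (Σ _ λ S → IsStable G S × ∣ S ∣ ≡ k) × (∀ S → IsStable G S → ∣ S ∣ ≤ k)

-- Split graphs: a KS-partition is given by the clique part K (S = complement of K)

IsKSPartition : {n : ℕ} → Graph n → Subset n → Set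
IsKSPartition G K = IsClique G K × IsStable G (∁ K)

IsSplit : {n : ℕ} → Graph n → Set
IsSplit G = ∃ λ K → IsKSPartition G K

IsBalanced : {n : ℕ} → Graph n → Set
IsBalanced G = ∃ λ K → IsKSPartition G K ×
  (∃ λ ω → ∃ λ α → IsCliqueNumber G ω × IsIndependenceNumber G α ×
     ∣ K ∣ ≡ ω × ∣ ∁ K ∣ ≡ α)

IsUnbalancedSplit : {n : ℕ} → Graph n → Set
IsUnbalancedSplit G = IsSplit G × ¬ IsBalanced G

UnbalancedSplitGraphs : ℕ → Setoid _ _
UnbalancedSplitGraphs n = record
  { Carrier = Σ (Graph n) IsUnbalancedSplit
  ; _≈_ = λ G H → proj₁ G ≅ proj₁ H
  ; isEquivalence = record { refl = λ {G} → ≅-refl {G = proj₁ G} ; sym = λ {G} {H} → ≅-sym {G = proj₁ G} {proj₁ H} ; trans = λ {G} {H} {K} → ≅-trans {G = proj₁ G} {proj₁ H} {proj₁ K} }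
  }

module Submission where

-- Call a vertex v of a graph a swing vertex if its neighbours are pairwise adjacent and its
-- non-neighbours are pairwise non-adjacent.  The bijection sends an XY-graph H on n vertices to
-- its cone on n + 1 vertices: a new vertex 0 is joined to every vertex of X, X is turned into a
-- clique, and the edges between X and Y are those of H.  The proof consists of four facts.
--   * A graph with a swing vertex v is an unbalanced split graph: N(v) and its complement form a
--     KS-partition, while the clique N(v) ∪ {v} and the stable set V ∖ N(v) together have one
--     vertex more than the graph, which ω + α = |V| forbids in a balanced graph.
--   * Conversely an unbalanced split graph has a swing vertex: if for a KS-partition no vertex of
--     S is complete to K and no vertex of K is anticomplete to S, an exchange argument shows that
--     K and S realise ω and α, so the graph is balanced.
--   * Vertex 0 of a cone is a swing vertex, and a graph with a swing vertex v is the cone of the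
--     XY-graph obtained by deleting v, taking X = N(v) and dropping the edges inside X.
--   * Any two swing vertices are twins, so transposing them is an automorphism; hence an
--     isomorphism of cones can be taken to fix 0, and it then restricts to an XY-isomorphism.

open import Defs
open import Data.Nat using (ℕ; suc; _+_; _≤_; s≤s)
open import Data.Nat.Properties using (m+[n∸m]≡n; 1+n≰n; +-mono-≤; +-monoˡ-≤; module ≤-Reasoning)
open import Data.Bool using (Bool; true; false; not; _∧_; _xor_; if_then_else_)
open import Data.Bool.Properties using (∧-comm; xor-comm; xor-same; ¬-not) renaming (_≟_ to _≟ᵇ_)
open import Data.Fin using (Fin; zero; suc) renaming (_≟_ to _≟ᶠ_)
open import Data.Fin.Properties using (any?; all?; ¬∀⟶∃¬; suc-injective)
open import Data.Fin.Subset using (Subset; inside; outside; _∈_; _∉_; ∁; ∣_∣; _⊆_; _∪_; _─_; _-_; ⁅_⁆)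
open import Data.Fin.Subset.Properties
  using (_∈?_; p⊆q⇒∣p∣≤∣q∣; p⊂q⇒∣p∣<∣q∣; p─q⊆p; p─⊥≡p; ∣p∣≤n; ∣∁p∣≡n∸∣p∣; x∈∁p⇒x∉p; x∉p⇒x∈∁p;
         x∉∁p⇒x∈p; x∈⁅x⁆; x∈⁅y⁆⇒x≡y; x∉⁅y⁆⇒x≢y; x∈p∧x≢y⇒x∈p-y; x∈p∪q⁺; x∈p∪q⁻)
open import Data.Fin.Permutation
  using (Permutation′; _⟨$⟩ʳ_; _⟨$⟩ˡ_; inverseˡ; inverseʳ; flip; transpose; remove; lift₀; lift₀-remove)
import Data.Fin.Permutation.Components as PC
open import Data.Vec using (_∷_; here; there; tabulate)
open import Data.Vec.Properties using ([]=⇒lookup; lookup⇒[]=; lookup∘tabulate)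
open import Data.Product using (Σ; ∃; _×_; _,_; proj₁; proj₂)
open import Data.Sum using (_⊎_; inj₁; inj₂)
open import Data.Empty using (⊥-elim)
open import Function.Bundles using (Bijection)
open import Relation.Nullary using (¬_; yes; no; does)
open import Relation.Nullary.Decidable using (_×-dec_; _→-dec_; ¬?; dec-true; dec-false; decidable-stable)
open import Relation.Binary.PropositionalEquality

private
  variable
    m n : ℕ

true≢false : true ≢ false
true≢false ()

≡-by-truth : {a b : Bool} → (a ≡ true → b ≡ true) → (b ≡ true → a ≡ true) → a ≡ b
≡-by-truth {true}  {b}     a⇒b _   = sym (a⇒b refl)
≡-by-truth {false} {true}  _   b⇒a = b⇒a refl
≡-by-truth {false} {false} _   _   = refl

permute-injective : (π : Permutation′ m) {i j : Fin m} → π ⟨$⟩ʳ i ≡ π ⟨$⟩ʳ j → i ≡ j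
permute-injective π {i} {j} πi≡πj =
  trans (sym (inverseˡ π)) (trans (cong (π ⟨$⟩ˡ_) πi≡πj) (inverseˡ π))

distinct : Fin m → Fin m → Bool
distinct i j = not (does (i ≟ᶠ j))

distinct-sym : (i j : Fin m) → distinct i j ≡ distinct j i
distinct-sym i j with i ≟ᶠ j | j ≟ᶠ i
... | yes _   | yes _   = refl
... | no  _   | no  _   = refl
... | yes i≡j | no  j≢i = ⊥-elim (j≢i (sym i≡j))
... | no  i≢j | yes j≡i = ⊥-elim (i≢j (sym j≡i))

distinct-self : (i : Fin m) → distinct i i ≡ false
distinct-self i = cong not (dec-true (i ≟ᶠ i) refl)

distinct-≢ : {i j : Fin m} → i ≢ j → distinct i j ≡ true
distinct-≢ {i = i} {j} i≢j = cong not (dec-false (i ≟ᶠ j) i≢j)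

distinct-permute : (π : Permutation′ m) (i j : Fin m) → distinct (π ⟨$⟩ʳ i) (π ⟨$⟩ʳ j) ≡ distinct i j
distinct-permute π i j with i ≟ᶠ j
... | yes refl = distinct-self (π ⟨$⟩ʳ i)
... | no  i≢j  = distinct-≢ (λ πi≡πj → i≢j (permute-injective π πi≡πj))

transpose-at-v : (v w : Fin m) → PC.transpose v w v ≡ w
transpose-at-v v w rewrite dec-true (v ≟ᶠ v) refl = refl

transpose-at-w : (v w : Fin m) → PC.transpose v w w ≡ v
transpose-at-w v w with w ≟ᶠ v
... | yes refl = refl
... | no  _   rewrite dec-true (w ≟ᶠ w) refl = refl

transpose-elsewhere : (v w : Fin m) {x : Fin m} → x ≢ v → x ≢ w → PC.transpose v w x ≡ x
transpose-elsewhere v w {x} x≢v x≢w rewrite dec-false (x ≟ᶠ v) x≢v | dec-false (x ≟ᶠ w) x≢w = refl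

x∈p─q⇒x∉q : {p q : Subset m} {x : Fin m} → x ∈ p ─ q → x ∉ q
x∈p─q⇒x∉q {p = _ ∷ _} {outside ∷ _} here        ()
x∈p─q⇒x∉q {p = _ ∷ _} {_ ∷ _}       (there x∈) (there x∈q) = x∈p─q⇒x∉q x∈ x∈q

∣p∣≡1+∣p-x∣ : {p : Subset m} {x : Fin m} → x ∈ p → ∣ p ∣ ≡ suc ∣ p - x ∣
∣p∣≡1+∣p-x∣ {p = inside  ∷ p} here        = cong suc (sym (cong ∣_∣ (p─⊥≡p p)))
∣p∣≡1+∣p-x∣ {p = inside  ∷ p} (there x∈p) = cong suc (∣p∣≡1+∣p-x∣ x∈p)
∣p∣≡1+∣p-x∣ {p = outside ∷ p} (there x∈p) = ∣p∣≡1+∣p-x∣ x∈p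

∣p∣+∣∁p∣≡n : (p : Subset m) → ∣ p ∣ + ∣ ∁ p ∣ ≡ m
∣p∣+∣∁p∣≡n p = trans (cong (∣ p ∣ +_) (∣∁p∣≡n∸∣p∣ p)) (m+[n∸m]≡n (∣p∣≤n p))

exchange-≤ : {p q : Subset m} {s k : Fin m} → s ∈ p → k ∈ q → k ∉ p →
             (∀ {x} → x ∈ p → x ≢ s → x ∈ q) → ∣ p ∣ ≤ ∣ q ∣
exchange-≤ {p = p} {q} {s} {k} s∈p k∈q k∉p rest⊆q = begin
  ∣ p ∣          ≡⟨ ∣p∣≡1+∣p-x∣ s∈p ⟩
  suc ∣ p - s ∣  ≤⟨ p⊂q⇒∣p∣<∣q∣ (p-s⊆q , k , k∈q , λ k∈p-s → k∉p (p─q⊆p p ⁅ s ⁆ k∈p-s)) ⟩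
  ∣ q ∣          ∎
  where
  open ≤-Reasoning
  p-s⊆q : p - s ⊆ q
  p-s⊆q x∈p-s = rest⊆q (p─q⊆p p ⁅ s ⁆ x∈p-s) (x∉⁅y⁆⇒x≢y (x∈p─q⇒x∉q x∈p-s))

almost-⊆⇒≤ : (C T : Subset m) →
             (∀ {x y} → x ∈ C → y ∈ C → x ∉ T → y ∉ T → x ≡ y) →
             (∀ {s} → s ∈ C → s ∉ T → ∃ λ k → k ∈ T × k ∉ C) → ∣ C ∣ ≤ ∣ T ∣
almost-⊆⇒≤ C T unique escape with any? (λ x → (x ∈? C) ×-dec ¬? (x ∈? T))
... | no C⊆T = p⊆q⇒∣p∣≤∣q∣ (λ {x} x∈C → decidable-stable (x ∈? T) (λ x∉T → C⊆T (x , x∈C , x∉T)))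
... | yes (s , s∈C , s∉T) with escape s∈C s∉T
...   | k , k∈T , k∉C = exchange-≤ s∈C k∈T k∉C λ {x} x∈C x≢s →
          decidable-stable (x ∈? T) (λ x∉T → x≢s (unique x∈C s∈C x∉T s∉T))

counterexample : (p : Subset m) (f : Fin m → Bool) (b : Bool) →
                 ¬ (∀ x → x ∈ p → f x ≡ b) → ∃ λ x → x ∈ p × f x ≡ not b
counterexample p f b fails
  with ¬∀⟶∃¬ _ (λ x → x ∈ p → f x ≡ b) (λ x → (x ∈? p) →-dec (f x ≟ᵇ b)) fails
... | x , ¬[x∈p⇒fx≡b] =
  x , decidable-stable (x ∈? p) (λ x∉p → ¬[x∈p⇒fx≡b] (λ x∈p → ⊥-elim (x∉p x∈p)))
    , ¬-not (λ fx≡b → ¬[x∈p⇒fx≡b] (λ _ → fx≡b))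

nbhd : Graph m → Fin m → Subset m
nbhd G v = tabulate (adj G v)

∈nbhd⇒adj : (G : Graph m) {v x : Fin m} → x ∈ nbhd G v → adj G v x ≡ true
∈nbhd⇒adj G {v} {x} x∈N = trans (sym (lookup∘tabulate (adj G v) x)) ([]=⇒lookup x∈N)

adj⇒∈nbhd : (G : Graph m) {v x : Fin m} → adj G v x ≡ true → x ∈ nbhd G v
adj⇒∈nbhd G {v} {x} vx = lookup⇒[]= x (nbhd G v) (trans (lookup∘tabulate (adj G v) x) vx)

∈∁nbhd⇒¬adj : (G : Graph m) {v x : Fin m} → x ∈ ∁ (nbhd G v) → adj G v x ≡ false
∈∁nbhd⇒¬adj G x∈∁N = ¬-not (λ vx → x∈∁p⇒x∉p x∈∁N (adj⇒∈nbhd G vx))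

record Swing (G : Graph m) (v : Fin m) : Set where
  field
    nbrs-clique    : ∀ x y → x ≢ y → adj G v x ≡ true → adj G v y ≡ true → adj G x y ≡ true
    nonnbrs-stable : ∀ x y → adj G v x ≡ false → adj G v y ≡ false → adj G x y ≡ false
open Swing

swing-transport : {G G′ : Graph m} (iso : G ≅ G′) {v : Fin m} → Swing G v → Swing G′ (proj₁ iso ⟨$⟩ʳ v)
swing-transport {G = G} {G′} (π , preserves) {v} swing = record
  { nbrs-clique    = λ x y x≢y vx vy → trans (pulled x y)
      (nbrs-clique swing _ _ (λ e → x≢y (permute-injective (flip π) e))
                   (trans (sym (pulled-v x)) vx) (trans (sym (pulled-v y)) vy))
  ; nonnbrs-stable = λ x y vx vy → trans (pulled x y)
      (nonnbrs-stable swing _ _ (trans (sym (pulled-v x)) vx) (trans (sym (pulled-v y)) vy))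
  }
  where
  pulled : ∀ a b → adj G′ a b ≡ adj G (π ⟨$⟩ˡ a) (π ⟨$⟩ˡ b)
  pulled a b = trans (cong₂ (adj G′) (sym (inverseʳ π)) (sym (inverseʳ π))) (preserves _ _)
  pulled-v : ∀ x → adj G′ (π ⟨$⟩ʳ v) x ≡ adj G v (π ⟨$⟩ˡ x)
  pulled-v x = trans (pulled _ x) (cong (λ u → adj G u (π ⟨$⟩ˡ x)) (inverseˡ π))

swing⇒KS : {G : Graph m} {v : Fin m} → Swing G v → IsKSPartition G (nbhd G v)
swing⇒KS {G = G} swing =
  (λ x y x∈N y∈N x≢y → nbrs-clique swing x y x≢y (∈nbhd⇒adj G x∈N) (∈nbhd⇒adj G y∈N)) ,
  (λ x y x∈S y∈S → nonnbrs-stable swing x y (∈∁nbhd⇒¬adj G x∈S) (∈∁nbhd⇒¬adj G y∈S))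

closed-nbhd-clique : {G : Graph m} {v : Fin m} → Swing G v → IsClique G (nbhd G v ∪ ⁅ v ⁆)
closed-nbhd-clique {G = G} {v} swing x y x∈N[v] y∈N[v] x≢y
  with x∈p∪q⁻ (nbhd G v) ⁅ v ⁆ x∈N[v] | x∈p∪q⁻ (nbhd G v) ⁅ v ⁆ y∈N[v]
... | inj₁ x∈N | inj₁ y∈N = proj₁ (swing⇒KS swing) x y x∈N y∈N x≢y
... | inj₁ x∈N | inj₂ y∈v rewrite x∈⁅y⁆⇒x≡y v y∈v = trans (adj-sym G x v) (∈nbhd⇒adj G x∈N)
... | inj₂ x∈v | inj₁ y∈N rewrite x∈⁅y⁆⇒x≡y v x∈v = ∈nbhd⇒adj G y∈N
... | inj₂ x∈v | inj₂ y∈v = ⊥-elim (x≢y (trans (x∈⁅y⁆⇒x≡y v x∈v) (sym (x∈⁅y⁆⇒x≡y v y∈v))))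

closed-nbhd-size : (G : Graph m) (v : Fin m) → suc ∣ nbhd G v ∣ ≤ ∣ nbhd G v ∪ ⁅ v ⁆ ∣
closed-nbhd-size G v = begin
  suc ∣ nbhd G v ∣               ≤⟨ s≤s (p⊆q⇒∣p∣≤∣q∣ N⊆N[v]-v) ⟩
  suc ∣ (nbhd G v ∪ ⁅ v ⁆) - v ∣  ≡⟨ sym (∣p∣≡1+∣p-x∣ (x∈p∪q⁺ {p = nbhd G v} (inj₂ (x∈⁅x⁆ v)))) ⟩
  ∣ nbhd G v ∪ ⁅ v ⁆ ∣            ∎
  where
  open ≤-Reasoning
  N⊆N[v]-v : nbhd G v ⊆ (nbhd G v ∪ ⁅ v ⁆) - v
  N⊆N[v]-v x∈N = x∈p∧x≢y⇒x∈p-y (x∈p∪q⁺ {q = ⁅ v ⁆} (inj₁ x∈N))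
    (λ { refl → true≢false (trans (sym (∈nbhd⇒adj G x∈N)) (adj-irrefl G v)) })

balanced⇒clique+stable≤n : (G : Graph m) → IsBalanced G → (C S : Subset m) →
                           IsClique G C → IsStable G S → ∣ C ∣ + ∣ S ∣ ≤ m
balanced⇒clique+stable≤n G (K , _ , ω , α , (_ , ω-max) , (_ , α-max) , ∣K∣≡ω , ∣S∣≡α) C S C-clique S-stable =
  begin
  ∣ C ∣ + ∣ S ∣    ≤⟨ +-mono-≤ (ω-max C C-clique) (α-max S S-stable) ⟩
  ω + α            ≡⟨ cong₂ _+_ (sym ∣K∣≡ω) (sym ∣S∣≡α) ⟩
  ∣ K ∣ + ∣ ∁ K ∣  ≡⟨ ∣p∣+∣∁p∣≡n K ⟩
  _                ∎
  where open ≤-Reasoning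

swing⇒unbalanced-split : {G : Graph m} {v : Fin m} → Swing G v → IsUnbalancedSplit G
swing⇒unbalanced-split {m = m} {G} {v} swing = (nbhd G v , swing⇒KS swing) , unbalanced
  where
  open ≤-Reasoning
  unbalanced : ¬ IsBalanced G
  unbalanced balanced = 1+n≰n (begin
    suc m                                     ≡⟨ cong suc (sym (∣p∣+∣∁p∣≡n (nbhd G v))) ⟩
    suc ∣ nbhd G v ∣ + ∣ ∁ (nbhd G v) ∣        ≤⟨ +-monoˡ-≤ _ (closed-nbhd-size G v) ⟩
    ∣ nbhd G v ∪ ⁅ v ⁆ ∣ + ∣ ∁ (nbhd G v) ∣    ≤⟨ balanced⇒clique+stable≤n G balanced
                                                    (nbhd G v ∪ ⁅ v ⁆) (∁ (nbhd G v))
                                                    (closed-nbhd-clique swing) (proj₂ (swing⇒KS swing)) ⟩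
    m                                         ∎)

module _ (G : Graph m) (K : Subset m) (K-clique : IsClique G K) (S-stable : IsStable G (∁ K)) where

  private
    ∉K⇒∈S : {x : Fin m} → x ∉ K → x ∈ ∁ K
    ∉K⇒∈S = x∉p⇒x∈∁p

    S∌K : {s k : Fin m} → s ∈ ∁ K → k ∈ K → s ≢ k
    S∌K s∈S k∈K refl = x∈∁p⇒x∉p s∈S k∈K

    S-nbr∈K : {s x : Fin m} → s ∈ ∁ K → adj G s x ≡ true → x ∈ K
    S-nbr∈K {s} {x} s∈S sx = decidable-stable (x ∈? K) λ x∉K →
      true≢false (trans (sym sx) (S-stable s x s∈S (∉K⇒∈S x∉K)))

  complete⇒swing : {s : Fin m} → s ∈ ∁ K → (∀ k → k ∈ K → adj G s k ≡ true) → Swing G s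
  complete⇒swing {s} s∈S complete = record
    { nbrs-clique    = λ x y x≢y sx sy → K-clique x y (S-nbr∈K s∈S sx) (S-nbr∈K s∈S sy) x≢y
    ; nonnbrs-stable = λ x y sx sy → S-stable x y (non-nbr∈S sx) (non-nbr∈S sy)
    }
    where
    non-nbr∈S : ∀ {x} → adj G s x ≡ false → x ∈ ∁ K
    non-nbr∈S {x} sx = ∉K⇒∈S λ x∈K → true≢false (trans (sym (complete x x∈K)) sx)

  anticomplete⇒swing : {k : Fin m} → k ∈ K → (∀ s → s ∈ ∁ K → adj G k s ≡ false) → Swing G k
  anticomplete⇒swing {k} k∈K anticomplete = record
    { nbrs-clique    = λ x y x≢y kx ky → K-clique x y (nbr∈K kx) (nbr∈K ky) x≢y
    ; nonnbrs-stable = non-nbrs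
    }
    where
    nbr∈K : ∀ {x} → adj G k x ≡ true → x ∈ K
    nbr∈K {x} kx = x∉∁p⇒x∈p λ x∈S → true≢false (trans (sym kx) (anticomplete x x∈S))
    non-nbr : ∀ {x} → adj G k x ≡ false → x ≡ k ⊎ x ∈ ∁ K
    non-nbr {x} kx with x ≟ᶠ k | x ∈? K
    ... | yes x≡k | _     = inj₁ x≡k
    ... | no  _   | no x∉K = inj₂ (∉K⇒∈S x∉K)
    ... | no  x≢k | yes x∈K =
      ⊥-elim (true≢false (trans (sym (K-clique k x k∈K x∈K (λ k≡x → x≢k (sym k≡x)))) kx))
    non-nbrs : ∀ x y → adj G k x ≡ false → adj G k y ≡ false → adj G x y ≡ false
    non-nbrs x y kx ky with non-nbr kx | non-nbr ky
    ... | inj₁ refl | inj₁ refl = adj-irrefl G k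
    ... | inj₁ refl | inj₂ _    = ky
    ... | inj₂ _    | inj₁ refl = trans (adj-sym G x k) kx
    ... | inj₂ x∈S  | inj₂ y∈S  = S-stable x y x∈S y∈S

  no-swing⇒balanced : (∀ s → s ∈ ∁ K → ∃ λ k → k ∈ K × adj G s k ≡ false) →
                      (∀ k → k ∈ K → ∃ λ s → s ∈ ∁ K × adj G k s ≡ true) → IsBalanced G
  no-swing⇒balanced misses sees =
    K , (K-clique , S-stable) , ∣ K ∣ , ∣ ∁ K ∣ ,
    ((K , K-clique , refl) , clique-bound) , ((∁ K , S-stable , refl) , stable-bound) , refl , refl
    where
    clique-bound : ∀ C → IsClique G C → ∣ C ∣ ≤ ∣ K ∣
    clique-bound C C-clique = almost-⊆⇒≤ C K unique escape
      where
      unique : ∀ {x y} → x ∈ C → y ∈ C → x ∉ K → y ∉ K → x ≡ y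
      unique {x} {y} x∈C y∈C x∉K y∉K = decidable-stable (x ≟ᶠ y) λ x≢y →
        true≢false (trans (sym (C-clique x y x∈C y∈C x≢y)) (S-stable x y (∉K⇒∈S x∉K) (∉K⇒∈S y∉K)))
      escape : ∀ {s} → s ∈ C → s ∉ K → ∃ λ k → k ∈ K × k ∉ C
      escape {s} s∈C s∉K with misses s (∉K⇒∈S s∉K)
      ... | k , k∈K , sk = k , k∈K , λ k∈C →
        true≢false (trans (sym (C-clique s k s∈C k∈C (S∌K (∉K⇒∈S s∉K) k∈K))) sk)
    stable-bound : ∀ A → IsStable G A → ∣ A ∣ ≤ ∣ ∁ K ∣
    stable-bound A A-stable = almost-⊆⇒≤ A (∁ K) unique escape
      where
      unique : ∀ {x y} → x ∈ A → y ∈ A → x ∉ ∁ K → y ∉ ∁ K → x ≡ y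
      unique {x} {y} x∈A y∈A x∉S y∉S = decidable-stable (x ≟ᶠ y) λ x≢y →
        true≢false (trans (sym (K-clique x y (x∉∁p⇒x∈p x∉S) (x∉∁p⇒x∈p y∉S) x≢y)) (A-stable x y x∈A y∈A))
      escape : ∀ {k} → k ∈ A → k ∉ ∁ K → ∃ λ s → s ∈ ∁ K × s ∉ A
      escape {k} k∈A k∉S with sees k (x∉∁p⇒x∈p k∉S)
      ... | s , s∈S , ks = s , s∈S , λ s∈A → true≢false (trans (sym ks) (A-stable k s k∈A s∈A))

  unbalanced⇒swing : ¬ IsBalanced G → ∃ (Swing G)
  unbalanced⇒swing unbalanced
    with any? (λ s → (s ∈? ∁ K) ×-dec all? (λ k → (k ∈? K) →-dec (adj G s k ≟ᵇ true)))
  ... | yes (s , s∈S , complete) = s , complete⇒swing s∈S complete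
  ... | no no-complete
    with any? (λ k → (k ∈? K) ×-dec all? (λ s → (s ∈? ∁ K) →-dec (adj G k s ≟ᵇ false)))
  ...   | yes (k , k∈K , anticomplete) = k , anticomplete⇒swing k∈K anticomplete
  ...   | no no-anticomplete = ⊥-elim (unbalanced (no-swing⇒balanced misses sees))
    where
    misses : ∀ s → s ∈ ∁ K → ∃ λ k → k ∈ K × adj G s k ≡ false
    misses s s∈S = counterexample K (adj G s) true λ complete → no-complete (s , s∈S , complete)
    sees : ∀ k → k ∈ K → ∃ λ s → s ∈ ∁ K × adj G k s ≡ true
    sees k k∈K = counterexample (∁ K) (adj G k) false λ anti → no-anticomplete (k , k∈K , anti)

Twins : Graph m → Fin m → Fin m → Set
Twins G v w = ∀ x → x ≢ v → x ≢ w → adj G v x ≡ adj G w x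

-- A neighbour of one swing vertex v other than a second swing vertex w is a neighbour of w:
-- were it not, v and w would be adjacent (contradicting that N(v) is a clique) or not
-- (contradicting that the non-neighbours of w are independent).
swing-nbr-transfer : {G : Graph m} {v w x : Fin m} → Swing G v → Swing G w → x ≢ w →
                     adj G v x ≡ true → adj G w x ≡ true
swing-nbr-transfer {G = G} {v} {w} {x} swing-v swing-w x≢w vx with adj G w x in wx | adj G v w in vw
... | true  | _     = refl
... | false | true  = ⊥-elim (true≢false
  (trans (sym (nbrs-clique swing-v x w x≢w vx vw)) (trans (adj-sym G x w) wx)))
... | false | false = ⊥-elim (true≢false
  (trans (sym vx) (nonnbrs-stable swing-w v x (trans (adj-sym G w v) vw) wx)))

swings-are-twins : {G : Graph m} {v w : Fin m} → Swing G v → Swing G w → Twins G v w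
swings-are-twins swing-v swing-w x x≢v x≢w =
  ≡-by-truth (swing-nbr-transfer swing-v swing-w x≢w) (swing-nbr-transfer swing-w swing-v x≢v)

data Position (v w x : Fin m) : Set where
  at-v  : x ≡ v → Position v w x
  at-w  : x ≡ w → Position v w x
  other : x ≢ v → x ≢ w → Position v w x

position : (v w x : Fin m) → Position v w x
position v w x with x ≟ᶠ v | x ≟ᶠ w
... | yes x≡v | _       = at-v x≡v
... | no  _   | yes x≡w = at-w x≡w
... | no  x≢v | no  x≢w = other x≢v x≢w

twins-automorphism : (G : Graph m) (v w : Fin m) → Twins G v w →
                     ∀ x y → adj G (transpose v w ⟨$⟩ʳ x) (transpose v w ⟨$⟩ʳ y) ≡ adj G x y
twins-automorphism G v w twins x y with position v w x | position v w y
... | at-v refl | at-v refl rewrite transpose-at-v v w = trans (adj-irrefl G w) (sym (adj-irrefl G v))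
... | at-v refl | at-w refl rewrite transpose-at-v v w | transpose-at-w v w = adj-sym G w v
... | at-v refl | other y≢v y≢w rewrite transpose-at-v v w | transpose-elsewhere v w y≢v y≢w =
  sym (twins y y≢v y≢w)
... | at-w refl | at-v refl rewrite transpose-at-w v w | transpose-at-v v w = adj-sym G v w
... | at-w refl | at-w refl rewrite transpose-at-w v w = trans (adj-irrefl G v) (sym (adj-irrefl G w))
... | at-w refl | other y≢v y≢w rewrite transpose-at-w v w | transpose-elsewhere v w y≢v y≢w =
  twins y y≢v y≢w
... | other x≢v x≢w | at-v refl rewrite transpose-elsewhere v w x≢v x≢w | transpose-at-v v w =
  trans (adj-sym G x w) (trans (sym (twins x x≢v x≢w)) (adj-sym G v x))
... | other x≢v x≢w | at-w refl rewrite transpose-elsewhere v w x≢v x≢w | transpose-at-w v w =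
  trans (adj-sym G x v) (trans (twins x x≢v x≢w) (adj-sym G w x))
... | other x≢v x≢w | other y≢v y≢w
  rewrite transpose-elsewhere v w x≢v x≢w | transpose-elsewhere v w y≢v y≢w = refl

same-side⇒nonadjacent : (H : XYGraph n) (i j : Fin n) → side H i ≡ side H j → adj (graph H) i j ≡ false
same-side⇒nonadjacent H i j same with adj (graph H) i j in ij
... | true  = ⊥-elim (bipartite H i j ij same)
... | false = refl

coneAdj : XYGraph n → Fin (suc n) → Fin (suc n) → Bool
coneAdj H zero    zero    = false
coneAdj H zero    (suc j) = side H j
coneAdj H (suc i) zero    = side H i
coneAdj H (suc i) (suc j) = if side H i ∧ side H j then distinct i j else adj (graph H) i j

coneAdj-sym : (H : XYGraph n) (a b : Fin (suc n)) → coneAdj H a b ≡ coneAdj H b a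
coneAdj-sym H zero    zero    = refl
coneAdj-sym H zero    (suc j) = refl
coneAdj-sym H (suc i) zero    = refl
coneAdj-sym H (suc i) (suc j)
  rewrite ∧-comm (side H i) (side H j) | distinct-sym i j | adj-sym (graph H) i j = refl

coneAdj-irrefl : (H : XYGraph n) (a : Fin (suc n)) → coneAdj H a a ≡ false
coneAdj-irrefl H zero = refl
coneAdj-irrefl H (suc i) with side H i
... | true  = distinct-self i
... | false = adj-irrefl (graph H) i

cone : XYGraph n → Graph (suc n)
cone H = record { adj = coneAdj H ; adj-sym = coneAdj-sym H ; adj-irrefl = coneAdj-irrefl H }

cone-XY-edges : (H : XYGraph n) (i j : Fin n) →
                adj (graph H) i j ≡ (side H i xor side H j) ∧ coneAdj H (suc i) (suc j)
cone-XY-edges H i j with side H i in si | side H j in sj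
... | true  | true  = same-side⇒nonadjacent H i j (trans si (sym sj))
... | true  | false = refl
... | false | true  = refl
... | false | false = same-side⇒nonadjacent H i j (trans si (sym sj))

-- Vertex 0 of a cone is a swing vertex: its neighbours form the clique X, and its
-- non-neighbours are 0 and the stable set Y.
cone-swing : (H : XYGraph n) → Swing (cone H) zero
cone-swing H = record { nbrs-clique = nbrs ; nonnbrs-stable = nonnbrs }
  where
  nbrs : ∀ x y → x ≢ y → coneAdj H zero x ≡ true → coneAdj H zero y ≡ true → coneAdj H x y ≡ true
  nbrs (suc i) (suc j) i≢j si sj rewrite si | sj = distinct-≢ (λ i≡j → i≢j (cong suc i≡j))
  nonnbrs : ∀ x y → coneAdj H zero x ≡ false → coneAdj H zero y ≡ false → coneAdj H x y ≡ false
  nonnbrs zero    zero    _  _  = refl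
  nonnbrs zero    (suc j) _  sj = sj
  nonnbrs (suc i) zero    si _  = si
  nonnbrs (suc i) (suc j) si sj rewrite si = same-side⇒nonadjacent H i j (trans si (sym sj))

cone-cong : {H H′ : XYGraph n} → H ≅XY H′ → cone H ≅ cone H′
cone-cong {H = H} {H′} (π , preserves-adj , preserves-side) = lift₀ π , preserves
  where
  preserves : ∀ a b → coneAdj H′ (lift₀ π ⟨$⟩ʳ a) (lift₀ π ⟨$⟩ʳ b) ≡ coneAdj H a b
  preserves zero    zero    = refl
  preserves zero    (suc j) = preserves-side j
  preserves (suc i) zero    = preserves-side i
  preserves (suc i) (suc j)
    rewrite preserves-side i | preserves-side j | distinct-permute π i j | preserves-adj i j = refl

-- An isomorphism of cones may be taken to fix the apex 0: the image of 0 is a swing vertex,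
-- hence a twin of 0, and the two can be transposed.
cone-iso-fixing-0 : {H H′ : XYGraph n} → cone H ≅ cone H′ →
                    Σ (cone H ≅ cone H′) λ iso → proj₁ iso ⟨$⟩ʳ zero ≡ zero
cone-iso-fixing-0 {H = H} {H′} iso =
  ≅-trans {G = cone H} {cone H′} {cone H′} iso swap , transpose-at-v w zero
  where
  w : Fin _
  w = proj₁ iso ⟨$⟩ʳ zero
  swap : cone H′ ≅ cone H′
  swap = transpose w zero , twins-automorphism (cone H′) w zero
    (swings-are-twins (swing-transport iso (cone-swing H)) (cone-swing H′))

cone-injective : {H H′ : XYGraph n} → cone H ≅ cone H′ → H ≅XY H′
cone-injective {H = H} {H′} iso with cone-iso-fixing-0 iso
... | (π , preserves) , π0≡0 = ρ , preserves-adj , preserves-side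
  where
  ρ : Permutation′ _
  ρ = remove zero π
  π-suc : ∀ i → π ⟨$⟩ʳ suc i ≡ suc (ρ ⟨$⟩ʳ i)
  π-suc i = sym (lift₀-remove π π0≡0 (suc i))
  preserves-old : ∀ i j → coneAdj H′ (suc (ρ ⟨$⟩ʳ i)) (suc (ρ ⟨$⟩ʳ j)) ≡ coneAdj H (suc i) (suc j)
  preserves-old i j = trans (sym (cong₂ (coneAdj H′) (π-suc i) (π-suc j))) (preserves (suc i) (suc j))
  preserves-side : ∀ i → side H′ (ρ ⟨$⟩ʳ i) ≡ side H i
  preserves-side i = trans (sym (cong₂ (coneAdj H′) π0≡0 (π-suc i))) (preserves zero (suc i))
  preserves-adj : ∀ i j → adj (graph H′) (ρ ⟨$⟩ʳ i) (ρ ⟨$⟩ʳ j) ≡ adj (graph H) i j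
  preserves-adj i j = begin
    adj (graph H′) (ρ ⟨$⟩ʳ i) (ρ ⟨$⟩ʳ j)
      ≡⟨ cone-XY-edges H′ (ρ ⟨$⟩ʳ i) (ρ ⟨$⟩ʳ j) ⟩
    (side H′ (ρ ⟨$⟩ʳ i) xor side H′ (ρ ⟨$⟩ʳ j)) ∧ coneAdj H′ (suc (ρ ⟨$⟩ʳ i)) (suc (ρ ⟨$⟩ʳ j))
      ≡⟨ cong₂ _∧_ (cong₂ _xor_ (preserves-side i) (preserves-side j)) (preserves-old i j) ⟩
    (side H i xor side H j) ∧ coneAdj H (suc i) (suc j)
      ≡⟨ sym (cone-XY-edges H i j) ⟩
    adj (graph H) i j ∎
    where open ≡-Reasoning

-- The adjacency g of two vertices is determined by their sides a and b relative to a swing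
-- vertex once it is known on pairs of neighbours (where it is e) and of non-neighbours (false).
adjacency-by-sides : (a b e g : Bool) →
                     (a ≡ true → b ≡ true → g ≡ e) → (a ≡ false → b ≡ false → g ≡ false) →
                     g ≡ (if a ∧ b then e else (a xor b) ∧ g)
adjacency-by-sides true  true  e g both-nbrs _ = both-nbrs refl refl
adjacency-by-sides true  false e g _ _ = refl
adjacency-by-sides false true  e g _ _ = refl
adjacency-by-sides false false e g _ both-non-nbrs = both-non-nbrs refl refl

module _ (G : Graph (suc n)) (v : Fin (suc n)) where

  private
    σ : Permutation′ (suc n)
    σ = transpose zero v

    vertex : Fin n → Fin (suc n)
    vertex i = σ ⟨$⟩ʳ suc i

    extractSide : Fin n → Bool
    extractSide i = adj G v (vertex i)

    extractAdj : Fin n → Fin n → Bool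
    extractAdj i j = (extractSide i xor extractSide j) ∧ adj G (vertex i) (vertex j)

    extractAdj-sym : ∀ i j → extractAdj i j ≡ extractAdj j i
    extractAdj-sym i j
      rewrite xor-comm (extractSide i) (extractSide j) | adj-sym G (vertex i) (vertex j) = refl

    extractAdj-irrefl : ∀ i → extractAdj i i ≡ false
    extractAdj-irrefl i rewrite xor-same (extractSide i) = refl

    extract-bipartite : ∀ i j → extractAdj i j ≡ true → extractSide i ≢ extractSide j
    extract-bipartite i j ij same rewrite same | xor-same (extractSide j) = true≢false (sym ij)

  extract : XYGraph n
  extract = record
    { graph     = record { adj = extractAdj ; adj-sym = extractAdj-sym ; adj-irrefl = extractAdj-irrefl }
    ; side      = extractSide
    ; bipartite = extract-bipartite
    }

  extract-cone : Swing G v → cone extract ≅ G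
  extract-cone swing = σ , preserves
    where
    preserves : ∀ a b → adj G (σ ⟨$⟩ʳ a) (σ ⟨$⟩ʳ b) ≡ coneAdj extract a b
    preserves zero    zero    = adj-irrefl G v
    preserves zero    (suc j) = refl
    preserves (suc i) zero    = adj-sym G (vertex i) v
    preserves (suc i) (suc j) =
      adjacency-by-sides (extractSide i) (extractSide j) (distinct i j) _ both-nbrs
        (nonnbrs-stable swing (vertex i) (vertex j))
      where
      both-nbrs : extractSide i ≡ true → extractSide j ≡ true →
                  adj G (vertex i) (vertex j) ≡ distinct i j
      both-nbrs vi vj with i ≟ᶠ j
      ... | yes refl = adj-irrefl G (vertex i)
      ... | no  i≢j  =
        nbrs-clique swing (vertex i) (vertex j) (λ e → i≢j (suc-injective (permute-injective σ e))) vi vj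

theorem3p2 : (n : ℕ) → Bijection (XYGraphs n) (UnbalancedSplitGraphs (suc n))
theorem3p2 n = record
  { to        = λ H → cone H , swing⇒unbalanced-split (cone-swing H)
  ; cong      = cone-cong
  ; bijective = cone-injective , surjective
  }
  where
  surjective : ∀ (G : Σ (Graph (suc n)) IsUnbalancedSplit) →
               ∃ λ H → ∀ {H′} → H′ ≅XY H → cone H′ ≅ proj₁ G
  surjective (G , (K , K-clique , S-stable) , unbalanced)
    with unbalanced⇒swing G K K-clique S-stable unbalanced
  ... | v , swing = extract G v , λ {H′} H′≅H →
    ≅-trans {G = cone H′} {cone (extract G v)} {G} (cone-cong H′≅H) (extract-cone G v swing)
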